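{- Let $t\ge 4$ and let $U\subseteq V(F^{\circ}_t)$ with $|U|>3\cdot 2^{t-3}$. Then there exist $u,v,w\in U$ such that $(u,v,w)$ is a directed triple of $F^{\circ}_t$, i.e. $F^{\circ}_t$ has a directed path from $u$ to $w$ containing $v$ as an inner vertex.
   Context: For an integer $t\ge 2$, $F^{\circ}_t$ is the digraph whose vertices are the formal symbols $u_i^{i_1i_2\cdots i_n}$ with $1\le i\le t-1$, $n\ge 1$, $i_1,\dots,i_n$ positive integers and $i+i_1+\cdots+i_n=t$, and whose arcs are all pairs $(u_i^{i_1\cdots i_{n-1}i_n},\,u_i^{i_1\cdots i_{n-1}\,j\,(i_n-j)})$ with $i_n\ge 2$ and $1\le j\le i_n-1$. (In the standard naming of vertices of the iterated Mycielski graph $M^t(G)$, where $u_i$ is the root added when forming $M^i(G)$ from $M^{i-1}(G)$ and $y^{j}$ denotes the twin of a vertex $y$ of $M^s(G)$ in $M^{s+j}(G)=M(M^{s+j-1}(G))$, these symbols are exactly the "$t$-th roots" of $M^t(G)$ other than $u_t$.) -}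

module Defs where

open import Data.Nat using (ℕ; _+_; _∸_; _≤_; _<_)
open import Data.List using (List; []; _∷_; _++_; _∷ʳ_)
open import Data.Nat.ListAction using (sum)
open import Data.List.Relation.Unary.All using (All)
open import Data.Product using (_×_; _,_)
open import Relation.Binary.PropositionalEquality using (_≡_; _≢_)
open import Relation.Binary.Construct.Closure.Transitive using (TransClosure)

-- A formal symbol u_i^{i_1 ... i_n} is represented by the pair (i , i_1 ∷ ... ∷ i_n ∷ []).
Symbol : Set
Symbol = ℕ × List ℕ

record IsVertex (t : ℕ) (s : Symbol) : Set where
  constructor isVertex
  field
    i-pos   : 1 ≤ Data.Product.proj₁ s
    i-le    : Data.Product.proj₁ s ≤ t ∸ 1
    nonEmpty : Data.Product.proj₂ s ≢ []
    allPos  : All (1 ≤_) (Data.Product.proj₂ s)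
    total   : Data.Product.proj₁ s + sum (Data.Product.proj₂ s) ≡ t

-- Arcs of F°_t : u_i^{i_1..i_{n-1} i_n} → u_i^{i_1..i_{n-1} j (i_n - j)}, i_n ≥ 2, 1 ≤ j ≤ i_n - 1.
-- (This relation maps vertices of F°_t to vertices of F°_t, so the arc set of F°_t is
-- its restriction to vertices; paths between vertices stay among vertices.)
data Arc : Symbol → Symbol → Set where
  arc : ∀ i (ws : List ℕ) (a j : ℕ) → 2 ≤ a → 1 ≤ j → j ≤ a ∸ 1 →
        Arc (i , ws ∷ʳ a) (i , ws ++ (j ∷ (a ∸ j) ∷ []))

Path⁺ : Symbol → Symbol → Set
Path⁺ = TransClosure Arc

DirectedTriple : Symbol → Symbol → Symbol → Set
DirectedTriple u v w = Path⁺ u v × Path⁺ v w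

{-# OPTIONS --safe #-}
-- The vertex set of F°_{t+1} is partitioned into the shifted copy u_{i+1}^w and the nested
-- copy u_1^{i w} of F°_t (both embeddings preserve arcs, which act on the last index only) and
-- the apex u_1^t, which reaches every nested vertex by splitting t = i + Σ w one part at a time.
-- By induction on t, more than 2^{t-2} vertices contain a directed path: either one copy
-- holds more than 2^{t-3} of them, or the apex and a nested vertex form such a pair.
-- Likewise more than 3·2^{t-3} vertices contain a directed triple: either one copy holds
-- more than 3·2^{t-4} of them, or they include the apex and more than 2^{t-3} nested
-- vertices, and the apex extends a path among the latter to a triple.
module Submission where

open import Defs
open import Data.Nat using (ℕ; zero; suc; _+_; _*_; _∸_; _^_; _≤_; _<_; z≤n; s≤s; s<s⁻¹; _<?_)
open import Data.Nat.Properties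
open import Data.Nat.Solver using (module +-*-Solver)
open +-*-Solver using (solve; _:=_; con; _:+_; _:*_)
open import Data.Nat.ListAction using (sum)
open import Data.List using (List; []; _∷_; _++_; _∷ʳ_; length; mapMaybe)
import Data.List.Properties as List
open import Data.List.Relation.Unary.All using (All; []; _∷_)
import Data.List.Relation.Unary.All as All
open import Data.List.Relation.Unary.All.Properties using (All¬⇒¬Any)
open import Data.List.Relation.Unary.Any using (here; there)
open import Data.List.Relation.Unary.AllPairs using ([]; _∷_)
open import Data.List.Relation.Unary.Unique.Propositional using (Unique)
open import Data.List.Membership.Propositional using (_∈_; _∉_)
import Data.Product.Properties as Product
open import Data.List.Membership.DecPropositional (Product.≡-dec _≟_ (List.≡-dec _≟_))
  using (_∈?_)
open import Data.Maybe using (Maybe; just; nothing)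
open import Data.Product using (_×_; _,_; ∃-syntax)
open import Data.Sum using (_⊎_; inj₁; inj₂)
open import Function using (_∘_)
open import Relation.Nullary using (yes; no; contradiction)
open import Relation.Binary.Core using (Rel; _=[_]⇒_)
open import Relation.Binary.PropositionalEquality
open import Relation.Binary.Construct.Closure.Transitive using (TransClosure; [_]; _∷_)

pigeonhole : ∀ {m n o p} → m + n < o + p → m < o ⊎ n < p
pigeonhole {m} {n} {o} {p} lt with m <? o | n <? p
... | yes m<o | _       = inj₁ m<o
... | no _    | yes n<p = inj₂ n<p
... | no m≮o  | no n≮p  = contradiction (+-mono-≤ (≮⇒≥ m≮o) (≮⇒≥ n≮p)) (<⇒≱ lt)

pigeonhole-≤ : ∀ {m n o p b l} → m + n ≤ b → b < l → l ≤ o + p → m < o ⊎ n < p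
pigeonhole-≤ b≤ lt l≤ = pigeonhole (≤-<-trans b≤ (<-≤-trans lt l≤))

pigeonhole-suc : ∀ {m n o p b l} → suc (m + n) ≤ b → b < l → l ≤ suc (o + p) → m < o ⊎ n < p
pigeonhole-suc b≤ lt l≤ = pigeonhole (s<s⁻¹ (≤-<-trans b≤ (<-≤-trans lt l≤)))

0<length⇒∈ : ∀ {A : Set} {xs : List A} → 0 < length xs → ∃[ x ] x ∈ xs
0<length⇒∈ {xs = x ∷ _} _ = x , here refl

TransClosure-map : ∀ {a b ℓ₁ ℓ₂} {A : Set a} {B : Set b} {R : Rel A ℓ₁} {S : Rel B ℓ₂}
  {f : A → B} → R =[ f ]⇒ S → TransClosure R =[ f ]⇒ TransClosure S
TransClosure-map R⇒S [ r ]     = [ R⇒S r ]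
TransClosure-map R⇒S (r ∷ rs) = R⇒S r ∷ TransClosure-map R⇒S rs

module Preimage {A B : Set} (embed : B → A) (restrict : A → Maybe B)
                (restrict-sound : ∀ {x z} → restrict x ≡ just z → embed z ≡ x) where

  preimage : List A → List B
  preimage = mapMaybe restrict

  ∈-preimage⁻ : ∀ {xs z} → z ∈ preimage xs → embed z ∈ xs
  ∈-preimage⁻ {x ∷ xs} z∈ with restrict x in eq
  ∈-preimage⁻ {x ∷ xs} z∈         | nothing = there (∈-preimage⁻ z∈)
  ∈-preimage⁻ {x ∷ xs} (here refl) | just _  = here (restrict-sound eq)
  ∈-preimage⁻ {x ∷ xs} (there z∈)  | just _  = there (∈-preimage⁻ z∈)

  All-preimage : ∀ {P : A → Set} {Q : B → Set} → (∀ {x z} → restrict x ≡ just z → P x → Q z) →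
    ∀ {xs} → All P xs → All Q (preimage xs)
  All-preimage P⇒Q []                 = []
  All-preimage P⇒Q {x ∷ xs} (px ∷ pxs) with restrict x in eq
  ... | nothing = All-preimage P⇒Q pxs
  ... | just z  = P⇒Q eq px ∷ All-preimage P⇒Q pxs

  Unique-preimage : ∀ {xs} → Unique xs → Unique (preimage xs)
  Unique-preimage []                     = []
  Unique-preimage {x ∷ xs} (x∉ ∷ uniq) with restrict x in eq
  ... | nothing = Unique-preimage uniq
  ... | just z  = All-preimage distinct x∉ ∷ Unique-preimage uniq
    where
    distinct : ∀ {y z′} → restrict y ≡ just z′ → x ≢ y → z ≢ z′
    distinct eq′ x≢y refl = x≢y (trans (sym (restrict-sound eq)) (restrict-sound eq′))

Forces : (List Symbol → Set) → ℕ → ℕ → Set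
Forces Has t b = ∀ U → All (IsVertex t) U → Unique U → b < length U → Has U

HasPath : List Symbol → Set
HasPath U = ∃[ u ] ∃[ v ] (u ∈ U × v ∈ U × Path⁺ u v)

HasDirectedTriple : List Symbol → Set
HasDirectedTriple U = ∃[ u ] ∃[ v ] ∃[ w ] (u ∈ U × v ∈ U × w ∈ U × DirectedTriple u v w)

module Embedding (embed : Symbol → Symbol) (restrict : Symbol → Maybe Symbol)
                 (restrict-sound : ∀ {x z} → restrict x ≡ just z → embed z ≡ x)
                 (embed-Arc : Arc =[ embed ]⇒ Arc)
                 (restrict-IsVertex : ∀ {t x z} → restrict x ≡ just z →
                                      IsVertex (suc t) x → IsVertex t z)
                 where

  open Preimage embed restrict restrict-sound public

  embed-Path⁺ : Path⁺ =[ embed ]⇒ Path⁺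
  embed-Path⁺ = TransClosure-map embed-Arc

  HasPath-preimage : ∀ {U} → HasPath (preimage U) → HasPath U
  HasPath-preimage (u , v , u∈ , v∈ , p) =
    embed u , embed v , ∈-preimage⁻ u∈ , ∈-preimage⁻ v∈ , embed-Path⁺ p

  HasDirectedTriple-preimage : ∀ {U} → HasDirectedTriple (preimage U) → HasDirectedTriple U
  HasDirectedTriple-preimage (u , v , w , u∈ , v∈ , w∈ , p , q) =
    embed u , embed v , embed w , ∈-preimage⁻ u∈ , ∈-preimage⁻ v∈ , ∈-preimage⁻ w∈ ,
    embed-Path⁺ p , embed-Path⁺ q

  All-IsVertex-preimage : ∀ {t U} → All (IsVertex (suc t)) U → All (IsVertex t) (preimage U)
  All-IsVertex-preimage = All-preimage restrict-IsVertex

  Forces-preimage : ∀ {Has t b} → (∀ {U} → Has (preimage U) → Has U) → Forces Has t b →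
    ∀ {U} → All (IsVertex (suc t)) U → Unique U → b < length (preimage U) → Has U
  Forces-preimage Has-preimage forces vs uniq large =
    Has-preimage (forces _ (All-IsVertex-preimage vs) (Unique-preimage uniq) large)

shift nest : Symbol → Symbol
shift (i , ws) = (suc i , ws)
nest  (i , ws) = (1 , i ∷ ws)

apex : ℕ → Symbol
apex t = (1 , t ∷ [])

-- unnest skips u_1^i, the image of the non-vertex (i , []); among vertices it is the apex.
unshift unnest : Symbol → Maybe Symbol
unshift (suc (suc i) , ws)  = just (suc i , ws)
unshift _                   = nothing
unnest (1 , i ∷ w ∷ ws)     = just (i , w ∷ ws)
unnest _                    = nothing

unshift-sound : ∀ {x z} → unshift x ≡ just z → shift z ≡ x
unshift-sound {suc (suc i) , ws} refl = refl

unnest-sound : ∀ {x z} → unnest x ≡ just z → nest z ≡ x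
unnest-sound {suc zero , i ∷ w ∷ ws} refl = refl

shift-Arc : Arc =[ shift ]⇒ Arc
shift-Arc (arc i ws a j 2≤a 1≤j j<a) = arc (suc i) ws a j 2≤a 1≤j j<a

nest-Arc : Arc =[ nest ]⇒ Arc
nest-Arc (arc i ws a j 2≤a 1≤j j<a) = arc 1 (i ∷ ws) a j 2≤a 1≤j j<a

IsVertex⇒1<t : ∀ {t x} → IsVertex t x → 1 < t
IsVertex⇒1<t (isVertex 1≤i i≤t∸1 _ _ _) = m∸n≢0⇒n<m (n>0⇒n≢0 (≤-trans 1≤i i≤t∸1))

mkIsVertex : ∀ {t i ws} → 1 ≤ i → All (1 ≤_) ws → ws ≢ [] → i + sum ws ≡ t → IsVertex t (i , ws)
mkIsVertex {ws = []} _ _ ws≢[] _ = contradiction refl ws≢[]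
mkIsVertex {i = i} {ws = suc w ∷ ws} 1≤i all-pos@(_ ∷ _) ws≢[] refl =
  isVertex 1≤i (subst (λ n → i ≤ n ∸ 1) (sym (+-suc i (w + sum ws))) (m≤m+n i _))
           ws≢[] all-pos refl

unshift-IsVertex : ∀ {t x z} → unshift x ≡ just z → IsVertex (suc t) x → IsVertex t z
unshift-IsVertex {x = suc (suc i) , ws} refl (isVertex _ _ ws≢[] all-pos total) =
  mkIsVertex (s≤s z≤n) all-pos ws≢[] (suc-injective total)

unnest-IsVertex : ∀ {t x z} → unnest x ≡ just z → IsVertex (suc t) x → IsVertex t z
unnest-IsVertex {x = suc zero , i ∷ w ∷ ws} refl (isVertex _ _ _ (1≤i ∷ all-pos) total) =
  mkIsVertex 1≤i all-pos (λ ()) (suc-injective total)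

module Shift = Embedding shift unshift unshift-sound shift-Arc unshift-IsVertex
module Nest  = Embedding nest unnest unnest-sound nest-Arc unnest-IsVertex

data Decomposition (t : ℕ) : Symbol → Set where
  nested  : ∀ i w ws → Decomposition t (1 , i ∷ w ∷ ws)
  shifted : ∀ i ws → Decomposition t (suc (suc i) , ws)
  is-apex : Decomposition t (apex t)

decompose : ∀ {t x} → IsVertex (suc t) x → Decomposition t x
decompose {x = zero , _} v = contradiction (IsVertex.i-pos v) λ ()
decompose {x = suc (suc i) , ws} _ = shifted i ws
decompose {x = 1 , []} v = contradiction refl (IsVertex.nonEmpty v)
decompose {x = 1 , i ∷ w ∷ ws} _ = nested i w ws
decompose {x = 1 , w ∷ []} v
  with refl ← trans (sym (+-identityʳ w)) (suc-injective (IsVertex.total v)) = is-apex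

length-≤-preimages : ∀ {t U} → All (IsVertex (suc t)) U → apex t ∉ U →
  length U ≤ length (Nest.preimage U) + length (Shift.preimage U)
length-≤-preimages [] _ = z≤n
length-≤-preimages (v ∷ vs) apex∉ with decompose v
... | nested _ _ _ = s≤s (length-≤-preimages vs (apex∉ ∘ there))
... | shifted _ _ =
  ≤-trans (s≤s (length-≤-preimages vs (apex∉ ∘ there))) (≤-reflexive (sym (+-suc _ _)))
... | is-apex = contradiction (here refl) apex∉

length-≤-suc-preimages : ∀ {t U} → All (IsVertex (suc t)) U → Unique U →
  length U ≤ suc (length (Nest.preimage U) + length (Shift.preimage U))
length-≤-suc-preimages [] _ = z≤n
length-≤-suc-preimages (v ∷ vs) (x∉ ∷ uniq) with decompose v
... | nested _ _ _ = s≤s (length-≤-suc-preimages vs uniq)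
... | shifted _ _ =
  ≤-trans (s≤s (length-≤-suc-preimages vs uniq)) (s≤s (≤-reflexive (sym (+-suc _ _))))
... | is-apex = s≤s (length-≤-preimages vs (All¬⇒¬Any x∉))

split-Arc : ∀ i p {w s} → 1 ≤ w → 1 ≤ s → Arc (i , p ∷ʳ (w + s)) (i , p ++ w ∷ s ∷ [])
split-Arc i p {w} {s} 1≤w 1≤s = subst (λ r → Arc (i , p ∷ʳ (w + s)) (i , p ++ w ∷ r ∷ []))
  (m+n∸m≡n w s)
  (arc i p (w + s) w (+-mono-≤ 1≤w 1≤s) 1≤w
       (subst (w ≤_) (sym (+-∸-assoc w 1≤s)) (m≤m+n w (s ∸ 1))))

split-Path⁺ : ∀ i p w ws → 1 ≤ w → All (1 ≤_) ws → ws ≢ [] →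
  Path⁺ (i , p ∷ʳ (w + sum ws)) (i , p ++ w ∷ ws)
split-Path⁺ i p w [] _ _ ws≢[] = contradiction refl ws≢[]
split-Path⁺ i p w (w′ ∷ []) 1≤w (1≤w′ ∷ []) _ rewrite +-identityʳ w′ = [ split-Arc i p 1≤w 1≤w′ ]
split-Path⁺ i p w (w′ ∷ ws@(_ ∷ _)) 1≤w (1≤w′ ∷ all-pos) _ =
  split-Arc i p 1≤w (≤-trans 1≤w′ (m≤m+n w′ (sum ws)))
  ∷ subst₂ (λ q r → Path⁺ (i , q) (i , r)) (List.++-assoc p _ _) (List.++-assoc p _ _)
      (split-Path⁺ i (p ∷ʳ w) w′ ws 1≤w′ all-pos (λ ()))

apex-Path⁺-nest : ∀ {t z} → IsVertex t z → Path⁺ (apex t) (nest z)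
apex-Path⁺-nest {z = i , ws} (isVertex 1≤i _ ws≢[] all-pos refl) =
  split-Path⁺ 1 [] i ws 1≤i all-pos ws≢[]

antichainBound : ℕ → ℕ
antichainBound (suc (suc n)) = 2 ^ n
antichainBound _             = 0

tripleFreeBound : ℕ → ℕ
tripleFreeBound (suc (suc (suc n))) = 3 * 2 ^ n
tripleFreeBound 2                   = 1
tripleFreeBound _                   = 0

x+x≡2*x : ∀ x → x + x ≡ 2 * x
x+x≡2*x = solve 1 (λ x → x :+ x := con 2 :* x) refl

3*x+3*x≡3*[2*x] : ∀ x → 3 * x + 3 * x ≡ 3 * (2 * x)
3*x+3*x≡3*[2*x] = solve 1 (λ x → con 3 :* x :+ con 3 :* x := con 3 :* (con 2 :* x)) refl

x+[2*x+3*x]≡3*[2*x] : ∀ x → x + (2 * x + 3 * x) ≡ 3 * (2 * x)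
x+[2*x+3*x]≡3*[2*x] =
  solve 1 (λ x → x :+ (con 2 :* x :+ con 3 :* x) := con 3 :* (con 2 :* x)) refl

antichainBound-+ : ∀ k →
  antichainBound (suc k) + antichainBound (suc k) ≤ antichainBound (suc (suc k))
antichainBound-+ zero    = z≤n
antichainBound-+ (suc n) = ≤-reflexive (x+x≡2*x (2 ^ n))

antichainBound-suc : ∀ k → suc (antichainBound (suc k)) ≤ antichainBound (suc (suc k))
antichainBound-suc zero    = ≤-refl
antichainBound-suc (suc n) =
  ≤-trans (+-monoˡ-≤ (2 ^ n) (m^n>0 2 n)) (≤-reflexive (x+x≡2*x (2 ^ n)))

tripleFreeBound-+ : ∀ k →
  tripleFreeBound (suc k) + tripleFreeBound (suc k) ≤ tripleFreeBound (suc (suc k))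
tripleFreeBound-+ zero          = z≤n
tripleFreeBound-+ (suc zero)    = s≤s (s≤s z≤n)
tripleFreeBound-+ (suc (suc n)) = ≤-reflexive (3*x+3*x≡3*[2*x] (2 ^ n))

tripleFreeBound-suc : ∀ k →
  suc (antichainBound (suc k) + tripleFreeBound (suc k)) ≤ tripleFreeBound (suc (suc k))
tripleFreeBound-suc zero          = ≤-refl
tripleFreeBound-suc (suc zero)    = ≤-refl
tripleFreeBound-suc (suc (suc n)) =
  ≤-trans (+-monoˡ-≤ _ (m^n>0 2 n)) (≤-reflexive (x+[2*x+3*x]≡3*[2*x] (2 ^ n)))

apex-HasPath : ∀ {t U} → All (IsVertex (suc t)) U → apex t ∈ U →
  0 < length (Nest.preimage U) → HasPath U
apex-HasPath vs apex∈ nonempty with z , z∈ ← 0<length⇒∈ nonempty =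
  apex _ , nest z , apex∈ , Nest.∈-preimage⁻ z∈ ,
  apex-Path⁺-nest (All.lookup (Nest.All-IsVertex-preimage vs) z∈)

Forces-≤1 : ∀ {Has t b} → t ≤ 1 → Forces Has t b
Forces-≤1 t≤1 (_ ∷ _) (v ∷ _) _ _ = contradiction (IsVertex⇒1<t v) (≤⇒≯ t≤1)

HasPath-step : ∀ k → Forces HasPath (suc k) (antichainBound (suc k)) →
  Forces HasPath (suc (suc k)) (antichainBound (suc (suc k)))
HasPath-step k forces U vs uniq large with apex (suc k) ∈? U
... | no apex∉ with pigeonhole-≤ (antichainBound-+ k) large (length-≤-preimages vs apex∉)
...   | inj₁ nest-large  = Nest.Forces-preimage Nest.HasPath-preimage forces vs uniq nest-large
...   | inj₂ shift-large = Shift.Forces-preimage Shift.HasPath-preimage forces vs uniq shift-large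
HasPath-step k forces U vs uniq large | yes apex∈
  with pigeonhole-suc {m = 0} (antichainBound-suc k) large (length-≤-suc-preimages vs uniq)
... | inj₁ nest-nonempty = apex-HasPath vs apex∈ nest-nonempty
... | inj₂ shift-large   = Shift.Forces-preimage Shift.HasPath-preimage forces vs uniq shift-large

HasPath-forced : ∀ t → Forces HasPath t (antichainBound t)
HasPath-forced 0             = Forces-≤1 z≤n
HasPath-forced 1             = Forces-≤1 ≤-refl
HasPath-forced (suc (suc k)) = HasPath-step k (HasPath-forced (suc k))

apex-HasDirectedTriple : ∀ {t U} → All (IsVertex (suc t)) U → Unique U → apex t ∈ U →
  antichainBound t < length (Nest.preimage U) → HasDirectedTriple U
apex-HasDirectedTriple {t} vs uniq apex∈ nest-large
  with u , v , u∈ , v∈ , p ←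
         HasPath-forced t _ (Nest.All-IsVertex-preimage vs) (Nest.Unique-preimage uniq) nest-large =
  apex t , nest u , nest v , apex∈ , Nest.∈-preimage⁻ u∈ , Nest.∈-preimage⁻ v∈ ,
  apex-Path⁺-nest (All.lookup (Nest.All-IsVertex-preimage vs) u∈) , Nest.embed-Path⁺ p

HasDirectedTriple-step : ∀ k → Forces HasDirectedTriple (suc k) (tripleFreeBound (suc k)) →
  Forces HasDirectedTriple (suc (suc k)) (tripleFreeBound (suc (suc k)))
HasDirectedTriple-step k forces U vs uniq large with apex (suc k) ∈? U
... | no apex∉ with pigeonhole-≤ (tripleFreeBound-+ k) large (length-≤-preimages vs apex∉)
...   | inj₁ nest-large  = Nest.Forces-preimage Nest.HasDirectedTriple-preimage forces vs uniq nest-large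
...   | inj₂ shift-large = Shift.Forces-preimage Shift.HasDirectedTriple-preimage forces vs uniq shift-large
HasDirectedTriple-step k forces U vs uniq large | yes apex∈
  with pigeonhole-suc (tripleFreeBound-suc k) large (length-≤-suc-preimages vs uniq)
... | inj₁ nest-large  =
  apex-HasDirectedTriple vs uniq apex∈ nest-large
... | inj₂ shift-large = Shift.Forces-preimage Shift.HasDirectedTriple-preimage forces vs uniq shift-large

HasDirectedTriple-forced : ∀ t → Forces HasDirectedTriple t (tripleFreeBound t)
HasDirectedTriple-forced 0             = Forces-≤1 z≤n
HasDirectedTriple-forced 1             = Forces-≤1 ≤-refl
HasDirectedTriple-forced (suc (suc k)) = HasDirectedTriple-step k (HasDirectedTriple-forced (suc k))

corollary1 : (t : ℕ) → 4 ≤ t → (U : List Symbol) → All (IsVertex t) U → Unique U →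
    3 * 2 ^ (t ∸ 3) < length U →
    ∃[ u ] ∃[ v ] ∃[ w ] (u ∈ U × v ∈ U × w ∈ U × DirectedTriple u v w)
corollary1 t (s≤s (s≤s (s≤s (s≤s _)))) = HasDirectedTriple-forced t
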